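{- Let $M$ be a matroid and $e \notin E(M)$, and let $M'$ be a matroid with $M' \setminus e = M$ (a single-element extension of $M$ by $e$). Let $\mathcal{F}_M^{M'}$ be the collection of flats $F$ of $M$ such that $e \in \mathrm{cl}_{M'}(F)$. Then $\mathcal{F}_M^{M'}$ is a modular cut of $M$.
   Context: Matroids are possibly infinite, in the sense of Bruhn–Diestel–Kriesell–Pendavingh–Wollan: a matroid is a pair $(E,\mathcal{I})$ with $\varnothing\in\mathcal{I}$, $\mathcal{I}$ closed under subsets, satisfying the augmentation axiom (if $I,B\in\mathcal{I}$ with $B$ maximal and $I$ not maximal, there is $e\in B-I$ with $I\cup\{e\}\in\mathcal{I}$) and the maximality axiom (for $I\subseteq X\subseteq E$ with $I\in\mathcal I$, the family $\{J\in\mathcal{I}: I\subseteq J\subseteq X\}$ has a maximal element). A basis for a set $X$ is a maximal independent subset of $X$. For a family $\mathcal{X}$ of subsets of $E(M)$, an independent set $B$ of $M$ is a mutual basis for $\mathcal{X}$ if $B\cap X$ is a basis for $X$ for every $X\in\mathcal{X}$; $\mathcal{X}$ is a modular family if it has a mutual basis, and a pair $(X,Y)$ is modular if $\{X,Y\}$ is a modular family. A chain is a collection $\mathcal{C}$ of sets such that any two members are comparable under inclusion. A modular cut of $M$ is a collection $\mathcal{F}$ of flats of $M$ such that (i) if $F\in\mathcal{F}$ and $F'$ is a flat of $M$ with $F\subseteq F'$ then $F'\in\mathcal{F}$; (ii) if $(F,F')$ is a modular pair with $F,F'\in\mathcal{F}$, then $F\cap F'\in\mathcal{F}$; (iii)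 if $\mathcal{C}\subseteq\mathcal{F}$ is an infinite chain of flats that is a modular family, then $\bigcap\mathcal{C}\in\mathcal{F}$. -}

module Defs where

-- Possibly infinite matroids (Bruhn–Diestel–Kriesell–Pendavingh–Wollan),
-- with ground sets given as subsets of an ambient type U.
-- Subsets are Bool-valued predicates U → Bool (so intersections are
-- computable); membership is  X x ≡ true.

open import Data.Bool using (Bool; true; false; _∧_)
open import Data.Nat using (ℕ)
open import Data.Fin using (Fin)
open import Data.Product using (Σ; _×_; _,_; ∃)
open import Data.Sum using (_⊎_)
open import Relation.Nullary using (¬_)
open import Relation.Binary.PropositionalEquality using (_≡_; _≢_)
open import Function.Bundles using (_⇔_)

Subset : Set → Set
Subset U = U → Bool

module _ {U : Set} where

  infix 4 _∈_ _∉_ _⊆_ _≐_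
  _∈_ : U → Subset U → Set
  x ∈ X = X x ≡ true

  _∉_ : U → Subset U → Set
  x ∉ X = ¬ (x ∈ X)

  _⊆_ : Subset U → Subset U → Set
  X ⊆ Y = ∀ x → x ∈ X → x ∈ Y

  _≐_ : Subset U → Subset U → Set
  X ≐ Y = ∀ x → (x ∈ X) ⇔ (x ∈ Y)

  ∅ : Subset U
  ∅ _ = false

  _⊓_ : Subset U → Subset U → Subset U
  (X ⊓ Y) x = X x ∧ Y x

  IsInsert : Subset U → Subset U → U → Set
  IsInsert J I x = ∀ y → (y ∈ J) ⇔ (y ∈ I ⊎ y ≡ x)

  IsBigInter : Subset U → (Subset U → Set) → Set
  IsBigInter Z 𝒞 = ∀ x → (x ∈ Z) ⇔ (∀ C → 𝒞 C → x ∈ C)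

  Chain : (Subset U → Set) → Set
  Chain 𝒞 = ∀ C D → 𝒞 C → 𝒞 D → (C ⊆ D) ⊎ (D ⊆ C)

  InfiniteFamily : (Subset U → Set) → Set
  InfiniteFamily 𝒞 = ∀ (n : ℕ) → Σ (Fin n → Subset U) λ f →
    (∀ i → 𝒞 (f i)) × (∀ i j → i ≢ j → ¬ (f i ≐ f j))

record Matroid (U : Set) : Set₁ where
  field
    ground : Subset U
    indep  : Subset U → Set
    indep⊆ground : ∀ I → indep I → I ⊆ ground
    indep-∅ : indep ∅
    indep-↓ : ∀ I J → indep J → I ⊆ J → indep I

  IsBase : Subset U → Set
  IsBase B = indep B × (∀ J → indep J → B ⊆ J → J ⊆ B)

  field
    augmentation : ∀ I B → indep I → IsBase B → ¬ IsBase I →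
      Σ U λ x → x ∈ B × x ∉ I × Σ (Subset U) λ J → IsInsert J I x × indep J
    maximality : ∀ I X → indep I → I ⊆ X → X ⊆ ground →
      Σ (Subset U) λ J → indep J × I ⊆ J × J ⊆ X ×
        (∀ K → indep K → J ⊆ K → K ⊆ X → K ⊆ J)

module _ {U : Set} (M : Matroid U) where
  open Matroid M

  IsBasisOf : Subset U → Subset U → Set
  IsBasisOf B X = B ⊆ X × indep B × (∀ J → indep J → B ⊆ J → J ⊆ X → J ⊆ B)

  InCl : Subset U → U → Set
  InCl X x = x ∈ ground ×
    (x ∈ X ⊎ Σ (Subset U) λ I → indep I × I ⊆ X ×
       (∀ J → IsInsert J I x → ¬ indep J))

  IsFlat : Subset U → Set
  IsFlat F = F ⊆ ground × (∀ x → InCl F x → x ∈ F)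

  IsMutualBasis : Subset U → (Subset U → Set) → Set
  IsMutualBasis B 𝒳 = indep B × (∀ X → 𝒳 X → IsBasisOf (B ⊓ X) X)

  ModularFamily : (Subset U → Set) → Set
  ModularFamily 𝒳 = Σ (Subset U) λ B → IsMutualBasis B 𝒳

  ModularPair : Subset U → Subset U → Set
  ModularPair X Y = ModularFamily (λ Z → Z ≡ X ⊎ Z ≡ Y)

  record IsModularCut (𝓕 : Subset U → Set) : Set₁ where
    field
      flats : ∀ F → 𝓕 F → IsFlat F
      up-closed : ∀ F F' → 𝓕 F → IsFlat F' → F ⊆ F' → 𝓕 F'
      pair-closed : ∀ F F' → 𝓕 F → 𝓕 F' → ModularPair F F' → 𝓕 (F ⊓ F')
      chain-closed : ∀ (𝒞 : Subset U → Set) → (∀ C → 𝒞 C → 𝓕 C) →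
        InfiniteFamily 𝒞 → Chain 𝒞 → ModularFamily 𝒞 →
        ∀ Z → IsBigInter Z 𝒞 → 𝓕 Z

IsDeletion : {U : Set} → Matroid U → U → Matroid U → Set
IsDeletion M' e M =
  (∀ x → (x ∈ Matroid.ground M) ⇔ (x ∈ Matroid.ground M' × x ≢ e)) ×
  (∀ I → Matroid.indep M I ⇔ (Matroid.indep M' I × e ∉ I))

{-# OPTIONS --safe #-}
-- Let 𝒳 ⊆ 𝓕 be a nonempty modular family with mutual basis B and intersection Z. If (B ∩ Z) + e
-- were independent in M', extend it to an M'-basis K of B + e. Every B ∩ X with X ∈ 𝒳 is a basis
-- of X spanning e, so it is not contained in K. But a basis of B + e misses at most one element
-- of the independent set B (base exchange), so one element of B lies outside K and in every
-- X ∈ 𝒳, hence in B ∩ Z ⊆ K: a contradiction. Modular pairs and modular chains are such families,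
-- and upward closure is monotonicity of the closure.
module Submission where

open import Defs
open import Axiom.ExcludedMiddle using (ExcludedMiddle)
open import Data.Bool using (true; false)
open import Data.Empty using (⊥-elim)
open import Data.Fin using (zero)
open import Data.Product using (Σ; _×_; _,_; proj₁; proj₂)
open import Data.Sum using (_⊎_; inj₁; inj₂; [_,_]; map; map₂)
open import Function using (id; _∘_)
open import Function.Bundles using (_⇔_; mk⇔; Equivalence)
open import Level using (0ℓ)
open import Relation.Nullary using (¬_; yes; no; does)
open import Relation.Nullary.Decidable using (decidable-stable)
open import Relation.Binary.PropositionalEquality using (_≡_; refl; sym; trans; subst)

open Equivalence

module _ {U : Set} where

  ⊆-trans : ∀ {X Y Z : Subset U} → X ⊆ Y → Y ⊆ Z → X ⊆ Z
  ⊆-trans X⊆Y Y⊆Z x = Y⊆Z x ∘ X⊆Y x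

  ∈-⊓ : ∀ (X Y : Subset U) {x} → x ∈ X ⊓ Y ⇔ (x ∈ X × x ∈ Y)
  ∈-⊓ X Y {x} with X x | Y x
  ... | true  | true  = mk⇔ (λ _ → refl , refl) (λ _ → refl)
  ... | true  | false = mk⇔ (λ ()) (λ { (_ , ()) })
  ... | false | _     = mk⇔ (λ ()) (λ { (() , _) })

  p⊓q⊆p : ∀ (X Y : Subset U) → X ⊓ Y ⊆ X
  p⊓q⊆p X Y _ = proj₁ ∘ to (∈-⊓ X Y)

  p⊓q⊆q : ∀ (X Y : Subset U) → X ⊓ Y ⊆ Y
  p⊓q⊆q X Y _ = proj₂ ∘ to (∈-⊓ X Y)

  ⊓-IsBigInter : ∀ (X Y : Subset U) → IsBigInter (X ⊓ Y) (λ Z → Z ≡ X ⊎ Z ≡ Y)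
  ⊓-IsBigInter X Y x = mk⇔
    (λ { x∈X⊓Y _ (inj₁ refl) → p⊓q⊆p X Y x x∈X⊓Y ; x∈X⊓Y _ (inj₂ refl) → p⊓q⊆q X Y x x∈X⊓Y })
    (λ x∈both → from (∈-⊓ X Y) (x∈both X (inj₁ refl) , x∈both Y (inj₂ refl)))

-- Subsets are Bool-valued, so forming {x ∣ P x} needs P decided, which excluded middle does.
-- The constructions are opaque so that unification compares X ∪ Y rather than its unfolding.
module Classical (em : ExcludedMiddle 0ℓ) where

  ¬∀⇒∃¬ : ∀ {A : Set} {P Q : A → Set} → ¬ (∀ x → P x → Q x) → Σ A λ x → P x × ¬ Q x
  ¬∀⇒∃¬ {A} {P} {Q} ¬∀ with em {Σ A λ x → P x × ¬ Q x}
  ... | yes ∃¬ = ∃¬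
  ... | no ¬∃¬ = ⊥-elim (¬∀ λ x Px → decidable-stable em λ ¬Qx → ¬∃¬ (x , Px , ¬Qx))

  module _ {U : Set} where

    opaque
      ⟦_⟧ : (U → Set) → Subset U
      ⟦ P ⟧ x = does (em {P x})

      ∈-⟦⟧ : ∀ P {x} → x ∈ ⟦ P ⟧ ⇔ P x
      ∈-⟦⟧ P {x} with em {P x}
      ... | yes p  = mk⇔ (λ _ → p) (λ _ → refl)
      ... | no ¬p = mk⇔ (λ ()) (⊥-elim ∘ ¬p)

      infixl 6 _∪_ _∖_

      _∪_ : Subset U → Subset U → Subset U
      X ∪ Y = ⟦ (λ x → x ∈ X ⊎ x ∈ Y) ⟧

      _∖_ : Subset U → Subset U → Subset U
      X ∖ Y = ⟦ (λ x → x ∈ X × x ∉ Y) ⟧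

      ⁅_⁆ : U → Subset U
      ⁅ a ⁆ = ⟦ (λ x → x ≡ a) ⟧

      ∈-∪ : ∀ {X Y x} → x ∈ X ∪ Y ⇔ (x ∈ X ⊎ x ∈ Y)
      ∈-∪ {X} {Y} = ∈-⟦⟧ (λ x → x ∈ X ⊎ x ∈ Y)

      ∈-∖ : ∀ {X Y x} → x ∈ X ∖ Y ⇔ (x ∈ X × x ∉ Y)
      ∈-∖ {X} {Y} = ∈-⟦⟧ (λ x → x ∈ X × x ∉ Y)

      ∈-⁅⁆ : ∀ {a x} → x ∈ ⁅ a ⁆ ⇔ x ≡ a
      ∈-⁅⁆ {a} = ∈-⟦⟧ (λ x → x ≡ a)

    x∈⁅x⁆ : ∀ x → x ∈ ⁅ x ⁆
    x∈⁅x⁆ x = from ∈-⁅⁆ refl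

    p⊆p∪q : ∀ {X Y} → X ⊆ X ∪ Y
    p⊆p∪q _ = from ∈-∪ ∘ inj₁

    q⊆p∪q : ∀ {X Y} → Y ⊆ X ∪ Y
    q⊆p∪q _ = from ∈-∪ ∘ inj₂

    ∪-lub : ∀ {X Y Z} → X ⊆ Z → Y ⊆ Z → X ∪ Y ⊆ Z
    ∪-lub X⊆Z Y⊆Z x = [ X⊆Z x , Y⊆Z x ] ∘ to ∈-∪

    ⁅⁆⊆ : ∀ {a X} → a ∈ X → ⁅ a ⁆ ⊆ X
    ⁅⁆⊆ {X = X} a∈X x x∈⁅a⁆ = subst (_∈ X) (sym (to ∈-⁅⁆ x∈⁅a⁆)) a∈X

    p∖q⊆p : ∀ {X Y} → X ∖ Y ⊆ X
    p∖q⊆p _ = proj₁ ∘ to ∈-∖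

    ∪⁅⁆-IsInsert : ∀ X a → IsInsert (X ∪ ⁅ a ⁆) X a
    ∪⁅⁆-IsInsert X a y = mk⇔ (map₂ (to ∈-⁅⁆) ∘ to ∈-∪) (from ∈-∪ ∘ map₂ (from ∈-⁅⁆))

    IsInsert⇒∪⁅⁆⊆ : ∀ {J I a} → IsInsert J I a → I ∪ ⁅ a ⁆ ⊆ J
    IsInsert⇒∪⁅⁆⊆ J≐I+a y = from (J≐I+a y) ∘ map₂ (to ∈-⁅⁆) ∘ to ∈-∪


module _ {U : Set} (N : Matroid U) where
  open Matroid N

  InCl-mono : ∀ {X Y x} → X ⊆ Y → InCl N X x → InCl N Y x
  InCl-mono X⊆Y (x∈E , inj₁ x∈X) = x∈E , inj₁ (X⊆Y _ x∈X)
  InCl-mono X⊆Y (x∈E , inj₂ (I , iI , I⊆X , I+x-dep)) =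
    x∈E , inj₂ (I , iI , ⊆-trans I⊆X X⊆Y , I+x-dep)

  ⋂-flat : ∀ {𝒳 X₀ Z} → (∀ X → 𝒳 X → IsFlat N X) → 𝒳 X₀ → IsBigInter Z 𝒳 → IsFlat N Z
  ⋂-flat {𝒳} {X₀} {Z} flat X₀∈𝒳 Z≐⋂𝒳 = ⊆-trans Z⊆X₀ (proj₁ (flat X₀ X₀∈𝒳)) , cl-closed
    where
    Z⊆ : ∀ X → 𝒳 X → Z ⊆ X
    Z⊆ X X∈𝒳 x x∈Z = to (Z≐⋂𝒳 x) x∈Z X X∈𝒳
    Z⊆X₀ : Z ⊆ X₀
    Z⊆X₀ = Z⊆ X₀ X₀∈𝒳
    cl-closed : ∀ x → InCl N Z x → x ∈ Z
    cl-closed x x∈clZ = from (Z≐⋂𝒳 x) λ X X∈𝒳 → proj₂ (flat X X∈𝒳) x (InCl-mono (Z⊆ X X∈𝒳) x∈clZ)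

  extend-to-basis : ∀ {I X} → indep I → I ⊆ X → X ⊆ ground →
    Σ (Subset U) λ K → IsBasisOf N K X × I ⊆ K
  extend-to-basis {I} {X} iI I⊆X X⊆E with maximality I X iI I⊆X X⊆E
  ... | K , iK , I⊆K , K⊆X , maxK = K , (K⊆X , iK , maxK) , I⊆K

  extend-to-base : ∀ {I} → indep I → Σ (Subset U) λ B → IsBase B × I ⊆ B
  extend-to-base iI with extend-to-basis iI (indep⊆ground _ iI) (λ _ → id)
  ... | B , (_ , iB , maxB) , I⊆B = B , (iB , λ J iJ B⊆J → maxB J iJ B⊆J (indep⊆ground J iJ)) , I⊆B

  ⊓-⊆-basis : ∀ {K X J} → IsBasisOf N K X → indep J → K ⊆ J → J ⊓ X ⊆ K
  ⊓-⊆-basis {X = X} {J} (K⊆X , _ , maxK) iJ K⊆J =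
    maxK (J ⊓ X) (indep-↓ _ J iJ (p⊓q⊆p J X))
      (λ x x∈K → from (∈-⊓ J X) (K⊆J x x∈K , K⊆X x x∈K)) (p⊓q⊆q J X)

  module _ (em : ExcludedMiddle 0ℓ) where
    open Classical em

    basis-of-⊇base-is-base : ∀ {B X K} → IsBase B → B ⊆ X → IsBasisOf N K X → IsBase K
    basis-of-⊇base-is-base {B} {X} {K} bB B⊆X (K⊆X , iK , maxK) with em {IsBase K}
    ... | yes bK = bK
    ... | no ¬bK with augmentation K B iK bB ¬bK
    ...   | x , x∈B , x∉K , J , J≐K+x , iJ =
      ⊥-elim (x∉K (maxK J iJ K⊆J J⊆X x (from (J≐K+x x) (inj₂ refl))))
      where
      K⊆J : K ⊆ J
      K⊆J y = from (J≐K+x y) ∘ inj₁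
      J⊆X : J ⊆ X
      J⊆X y y∈J with to (J≐K+x y) y∈J
      ... | inj₁ y∈K = K⊆X y y∈K
      ... | inj₂ refl = B⊆X x x∈B

    extend-to-base-within : ∀ {I B} → indep I → IsBase B →
      Σ (Subset U) λ K → IsBase K × I ⊆ K × K ⊆ I ∪ B
    extend-to-base-within {I} {B} iI bB with extend-to-basis iI p⊆p∪q I∪B⊆E
      where
      I∪B⊆E : I ∪ B ⊆ ground
      I∪B⊆E = ∪-lub (indep⊆ground I iI) (indep⊆ground B (proj₁ bB))
    ... | K , bK@(K⊆I∪B , _) , I⊆K = K , basis-of-⊇base-is-base bB q⊆p∪q bK , I⊆K , K⊆I∪B

    base-exchange : ∀ {B B' a} → IsBase B → IsBase B' → a ∈ B → a ∉ B' →
      Σ U λ x → x ∈ B' × x ∉ B × indep (B ∖ ⁅ a ⁆ ∪ ⁅ x ⁆)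
    base-exchange {B} {B'} {a} (iB , _) bB' a∈B a∉B'
      with augmentation (B ∖ ⁅ a ⁆) B' (indep-↓ _ B iB p∖q⊆p) bB' B-a-not-base
      where
      B-a-not-base : ¬ IsBase (B ∖ ⁅ a ⁆)
      B-a-not-base (_ , maxB-a) = proj₂ (to ∈-∖ (maxB-a B iB p∖q⊆p a a∈B)) (x∈⁅x⁆ a)
    ... | x , x∈B' , x∉B-a , J , J≐B-a+x , iJ =
      x , x∈B' , x∉B , indep-↓ _ J iJ (IsInsert⇒∪⁅⁆⊆ J≐B-a+x)
      where
      x∉B : x ∉ B
      x∉B x∈B = x∉B-a (from ∈-∖ (x∈B , λ x∈⁅a⁆ → a∉B' (subst (_∈ B') (to ∈-⁅⁆ x∈⁅a⁆) x∈B')))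

    -- y ∈ cl(J) for some independent J ⊆ X. Exchanging y out of a base Î ⊇ I + y brings in an
    -- element of J ⊆ X, which would extend the basis I of X.
    basis-∪⁅⁆-dependent : ∀ {I X y} → IsBasisOf N I X → y ∉ X → InCl N X y → ¬ indep (I ∪ ⁅ y ⁆)
    basis-∪⁅⁆-dependent _ y∉X (_ , inj₁ y∈X) _ = y∉X y∈X
    basis-∪⁅⁆-dependent {I} {X} {y} bI@(I⊆X , _) y∉X (_ , inj₂ (J , iJ , J⊆X , J+y-dep)) iI+y
      with extend-to-base iI+y
    ... | Î , bÎ , I+y⊆Î
      with extend-to-base-within iJ bÎ
    ... | Ĵ , bĴ , J⊆Ĵ , Ĵ⊆J∪Î
      with base-exchange bÎ bĴ (I+y⊆Î y (q⊆p∪q y (x∈⁅x⁆ y))) y∉Ĵ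
      where
      y∉Ĵ : y ∉ Ĵ
      y∉Ĵ y∈Ĵ = J+y-dep (J ∪ ⁅ y ⁆) (∪⁅⁆-IsInsert J y)
        (indep-↓ _ Ĵ (proj₁ bĴ) (∪-lub J⊆Ĵ (⁅⁆⊆ y∈Ĵ)))
    ... | x , x∈Ĵ , x∉Î , iÎ-y+x =
      x∉Î (I+y⊆Î x (p⊆p∪q x (⊓-⊆-basis bI iÎ-y+x I⊆Î-y+x x x∈Î-y+x⊓X)))
      where
      I⊆Î-y+x : I ⊆ Î ∖ ⁅ y ⁆ ∪ ⁅ x ⁆
      I⊆Î-y+x i i∈I = p⊆p∪q i (from ∈-∖ (I+y⊆Î i (p⊆p∪q i i∈I) ,
        λ i∈⁅y⁆ → y∉X (subst (_∈ X) (to ∈-⁅⁆ i∈⁅y⁆) (I⊆X i i∈I))))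
      x∈J : x ∈ J
      x∈J = [ id , ⊥-elim ∘ x∉Î ] (to ∈-∪ (Ĵ⊆J∪Î x x∈Ĵ))
      x∈Î-y+x⊓X : x ∈ (Î ∖ ⁅ y ⁆ ∪ ⁅ x ⁆) ⊓ X
      x∈Î-y+x⊓X = from (∈-⊓ (Î ∖ ⁅ y ⁆ ∪ ⁅ x ⁆) X) (q⊆p∪q x (x∈⁅x⁆ x) , J⊆X x x∈J)

    -- Extend B to a base B̂ and K to a base K̂ ⊆ K ∪ B̂. Exchanging a out of B̂ can only bring
    -- in e, and then K ∪ (B ∖ a) ⊆ (B̂ ∖ a) + e is independent, so B ∖ a ⊆ K by maximality.
    basis-of-∪⁅⁆-misses-≤1 : ∀ {B K e a b} → indep B → IsBasisOf N K (B ∪ ⁅ e ⁆) →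
      a ∈ B → a ∉ K → b ∈ B → b ∉ K → b ≡ a
    basis-of-∪⁅⁆-misses-≤1 {B} {K} {e} {a} {b} iB bK@(K⊆B+e , iK , maxK) a∈B a∉K b∈B b∉K
      with extend-to-base iB
    ... | B̂ , bB̂ , B⊆B̂
      with extend-to-base-within iK bB̂
    ... | K̂ , bK̂ , K⊆K̂ , K̂⊆K∪B̂
      with base-exchange bB̂ bK̂ (B⊆B̂ a a∈B) a∉K̂
      where
      a∉K̂ : a ∉ K̂
      a∉K̂ a∈K̂ = a∉K (⊓-⊆-basis bK (proj₁ bK̂) K⊆K̂ a
        (from (∈-⊓ K̂ (B ∪ ⁅ e ⁆)) (a∈K̂ , p⊆p∪q a a∈B)))
    ... | x , x∈K̂ , x∉B̂ , iB̂-a+x = decidable-stable em λ b≢a →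
      b∉K (maxK L (indep-↓ L _ iB̂-a+x L⊆B̂-a+x) p⊆p∪q L⊆B+e b
        (q⊆p∪q b (from ∈-∖ (b∈B , b≢a ∘ to ∈-⁅⁆))))
      where
      x≡e : x ≡ e
      x≡e with to ∈-∪ (K̂⊆K∪B̂ x x∈K̂)
      ... | inj₂ x∈B̂ = ⊥-elim (x∉B̂ x∈B̂)
      ... | inj₁ x∈K = [ ⊥-elim ∘ x∉B̂ ∘ B⊆B̂ x , to ∈-⁅⁆ ] (to ∈-∪ (K⊆B+e x x∈K))
      L : Subset U
      L = K ∪ (B ∖ ⁅ a ⁆)
      L⊆B+e : L ⊆ B ∪ ⁅ e ⁆
      L⊆B+e = ∪-lub K⊆B+e (⊆-trans p∖q⊆p p⊆p∪q)
      B-a⊆B̂-a : B ∖ ⁅ a ⁆ ⊆ B̂ ∖ ⁅ a ⁆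
      B-a⊆B̂-a y y∈B-a = from ∈-∖ (B⊆B̂ y (p∖q⊆p y y∈B-a) , proj₂ (to ∈-∖ y∈B-a))
      K⊆B̂-a+x : K ⊆ B̂ ∖ ⁅ a ⁆ ∪ ⁅ x ⁆
      K⊆B̂-a+x y y∈K with to ∈-∪ (K⊆B+e y y∈K)
      ... | inj₁ y∈B = p⊆p∪q y (B-a⊆B̂-a y
        (from ∈-∖ (y∈B , λ y∈⁅a⁆ → a∉K (subst (_∈ K) (to ∈-⁅⁆ y∈⁅a⁆) y∈K))))
      ... | inj₂ y∈⁅e⁆ = q⊆p∪q y (from ∈-⁅⁆ (trans (to ∈-⁅⁆ y∈⁅e⁆) (sym x≡e)))
      L⊆B̂-a+x : L ⊆ B̂ ∖ ⁅ a ⁆ ∪ ⁅ x ⁆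
      L⊆B̂-a+x = ∪-lub K⊆B̂-a+x (⊆-trans B-a⊆B̂-a p⊆p∪q)

module SingleElementExtension (em : ExcludedMiddle 0ℓ) {U : Set} (M M' : Matroid U) (e : U)
  (e∉E : e ∉ Matroid.ground M) (e∈E' : e ∈ Matroid.ground M') (M'∖e≐M : IsDeletion M' e M) where
  open Classical em
  private
    module 𝕄 = Matroid M
    module 𝕄' = Matroid M'

  𝓕 : Subset U → Set
  𝓕 F = IsFlat M F × InCl M' F e

  indep⇒indep' : ∀ {I} → 𝕄.indep I → 𝕄'.indep I
  indep⇒indep' = proj₁ ∘ to (proj₂ M'∖e≐M _)

  basis⇒basis' : ∀ {A X} → X ⊆ 𝕄.ground → IsBasisOf M A X → IsBasisOf M' A X
  basis⇒basis' X⊆E (A⊆X , iA , maxA) = A⊆X , indep⇒indep' iA ,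
    λ J iJ A⊆J J⊆X → maxA J (from (proj₂ M'∖e≐M J) (iJ , λ e∈J → e∉E (X⊆E e (J⊆X e e∈J)))) A⊆J J⊆X

  𝓕-basis-⊈-indep∋e : ∀ {X A K} → 𝓕 X → IsBasisOf M A X → 𝕄'.indep K → e ∈ K → ¬ A ⊆ K
  𝓕-basis-⊈-indep∋e {K = K} ((X⊆E , _) , e∈cl'X) bA iK e∈K A⊆K =
    basis-∪⁅⁆-dependent M' em (basis⇒basis' X⊆E bA) (λ e∈X → e∉E (X⊆E e e∈X)) e∈cl'X
      (𝕄'.indep-↓ _ K iK (∪-lub A⊆K (⁅⁆⊆ e∈K)))

  ⋂-∈𝓕 : ∀ {𝒳 X₀ Z} → (∀ X → 𝒳 X → 𝓕 X) → ModularFamily M 𝒳 → 𝒳 X₀ → IsBigInter Z 𝒳 → 𝓕 Z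
  ⋂-∈𝓕 {𝒳} {X₀} {Z} 𝒳⊆𝓕 (B , iB , B-mutual) X₀∈𝒳 Z≐⋂𝒳 =
    ⋂-flat M (λ X → proj₁ ∘ 𝒳⊆𝓕 X) X₀∈𝒳 Z≐⋂𝒳 ,
    e∈E' , inj₂ (B ⊓ Z , indep⇒indep' (𝕄.indep-↓ _ B iB (p⊓q⊆p B Z)) , p⊓q⊆q B Z ,
                 B⊓Z+e-dependent)
    where
    B+e⊆E' : B ∪ ⁅ e ⁆ ⊆ 𝕄'.ground
    B+e⊆E' = ∪-lub (λ x → proj₁ ∘ to (proj₁ M'∖e≐M x) ∘ 𝕄.indep⊆ground B iB x) (⁅⁆⊆ e∈E')
    B⊓Z+e-dependent : ∀ J → IsInsert J (B ⊓ Z) e → ¬ 𝕄'.indep J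
    B⊓Z+e-dependent J J≐B⊓Z+e iJ with extend-to-basis M' iJ J⊆B+e B+e⊆E'
      where
      J⊆B+e : J ⊆ B ∪ ⁅ e ⁆
      J⊆B+e x = from ∈-∪ ∘ map (p⊓q⊆p B Z x) (from ∈-⁅⁆) ∘ to (J≐B⊓Z+e x)
    ... | K , bK@(_ , iK , _) , J⊆K = X₀-has-no-escapee (escapee X₀ X₀∈𝒳)
      where
      escapee : ∀ X → 𝒳 X → Σ U λ a → a ∈ B ⊓ X × a ∉ K
      escapee X X∈𝒳 = ¬∀⇒∃¬ (𝓕-basis-⊈-indep∋e (𝒳⊆𝓕 X X∈𝒳) (B-mutual X X∈𝒳) iK
        (J⊆K e (from (J≐B⊓Z+e e) (inj₂ refl))))
      X₀-has-no-escapee : ¬ (Σ U λ a → a ∈ B ⊓ X₀ × a ∉ K)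
      X₀-has-no-escapee (a₀ , a₀∈B⊓X₀ , a₀∉K) =
        a₀∉K (J⊆K a₀ (from (J≐B⊓Z+e a₀) (inj₁ (from (∈-⊓ B Z) (a₀∈B , from (Z≐⋂𝒳 a₀) a₀∈⋂𝒳)))))
        where
        a₀∈B : a₀ ∈ B
        a₀∈B = p⊓q⊆p B X₀ a₀ a₀∈B⊓X₀
        a₀∈⋂𝒳 : ∀ X → 𝒳 X → a₀ ∈ X
        a₀∈⋂𝒳 X X∈𝒳 with escapee X X∈𝒳
        ... | a , a∈B⊓X , a∉K = subst (_∈ X)
          (basis-of-∪⁅⁆-misses-≤1 M' em (indep⇒indep' iB) bK a₀∈B a₀∉K (p⊓q⊆p B X a a∈B⊓X) a∉K)
          (p⊓q⊆q B X a a∈B⊓X)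

  𝓕-isModularCut : IsModularCut M 𝓕
  𝓕-isModularCut = record
    { flats = λ _ → proj₁
    ; up-closed = λ _ _ (_ , e∈cl'F) F'-flat F⊆F' → F'-flat , InCl-mono M' F⊆F' e∈cl'F
    ; pair-closed = λ F F' F∈𝓕 F'∈𝓕 F,F'-modular →
        ⋂-∈𝓕 (λ { _ (inj₁ refl) → F∈𝓕 ; _ (inj₂ refl) → F'∈𝓕 }) F,F'-modular (inj₁ refl)
          (⊓-IsBigInter F F')
    ; chain-closed = λ _ 𝒞⊆𝓕 𝒞-infinite _ 𝒞-modular _ →
        ⋂-∈𝓕 𝒞⊆𝓕 𝒞-modular (proj₁ (proj₂ (𝒞-infinite 1)) zero)
    }

mainTheorem1 : ExcludedMiddle 0ℓ → {U : Set} (M M' : Matroid U) (e : U) →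
    e ∉ Matroid.ground M → e ∈ Matroid.ground M' → IsDeletion M' e M →
    IsModularCut M (λ F → IsFlat M F × InCl M' F e)
mainTheorem1 em M M' e = SingleElementExtension.𝓕-isModularCut em M M' e
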